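{- Let $g$ be a positive integer and $\ell$ a prime. Then $[\mathfrak{gsp}_{2g}(\mathbb Z/\ell\mathbb Z),\mathfrak{gsp}_{2g}(\mathbb Z/\ell\mathbb Z)]=\mathfrak{sp}_{2g}(\mathbb Z/\ell\mathbb Z)$.
   Context: Let $\Omega_{2g}$ be the Gram matrix of a nondegenerate alternating form on $R^{2g}$. For a commutative ring $R$, $\mathfrak{gsp}_{2g}(R)=\{\Lambda\in\mathrm{Mat}_{2g\times 2g}(R):\Lambda^T\Omega_{2g}+\Omega_{2g}\Lambda=d\,\Omega_{2g}\text{ for some }d\in R\}$ and $\mathfrak{sp}_{2g}(R)$ is the subset where $d=0$. The bracket $[\mathfrak g,\mathfrak g]$ denotes the additive span of all $XY-YX$ with $X,Y\in\mathfrak g$. -}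

module Defs where

open import Data.Nat as ℕ using (ℕ; zero; suc)
open import Data.Integer using (ℤ; +_; _+_; _*_; -_; _-_; 0ℤ; 1ℤ; -1ℤ)
open import Data.Integer.Divisibility using (_∣_)
open import Data.Fin using (Fin; toℕ)
import Data.Fin as F
open import Data.List using (List; foldr; map)
open import Data.List.Relation.Unary.All using (All)
open import Data.Product using (Σ; ∃; _×_; _,_; proj₁; proj₂)
open import Relation.Nullary using (yes; no)

-- square matrices of size n with integer entries; an entry is read modulo ℓ,
-- i.e. these represent matrices over ℤ/ℓℤ
Mat : ℕ → Set
Mat n = Fin n → Fin n → ℤ

Σfin : ∀ {n} → (Fin n → ℤ) → ℤ
Σfin {zero} f = 0ℤ
Σfin {suc n} f = f F.zero + Σfin (λ i → f (F.suc i))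

_⊕_ : ∀ {n} → Mat n → Mat n → Mat n
(A ⊕ B) i j = A i j + B i j

_⊖_ : ∀ {n} → Mat n → Mat n → Mat n
(A ⊖ B) i j = A i j - B i j

_⊛_ : ∀ {n} → Mat n → Mat n → Mat n
(A ⊛ B) i j = Σfin (λ k → A i k * B k j)

_·_ : ∀ {n} → ℤ → Mat n → Mat n
(c · A) i j = c * A i j

transpose : ∀ {n} → Mat n → Mat n
transpose A i j = A j i

zeroMat : ∀ {n} → Mat n
zeroMat i j = 0ℤ

_≡M_[mod_] : ∀ {n} → Mat n → Mat n → ℕ → Set
A ≡M B [mod ℓ ] = ∀ i j → (+ ℓ) ∣ (A i j - B i j)

-- the standard symplectic Gram matrix Ω_{2g} = [[0, I_g], [-I_g, 0]]
-- (indices of Fin (g + g): 0..g-1 first block, g..2g-1 second block)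
Ω : (g : ℕ) → Mat (g ℕ.+ g)
Ω g i j with toℕ j ℕ.≟ toℕ i ℕ.+ g | toℕ i ℕ.≟ toℕ j ℕ.+ g
... | yes _ | _     = 1ℤ
... | no _  | yes _ = -1ℤ
... | no _  | no _  = 0ℤ

InGsp : (g ℓ : ℕ) → Mat (g ℕ.+ g) → Set
InGsp g ℓ Λ = Σ ℤ λ d → ((transpose Λ ⊛ Ω g) ⊕ (Ω g ⊛ Λ)) ≡M (d · Ω g) [mod ℓ ]

InSp : (g ℓ : ℕ) → Mat (g ℕ.+ g) → Set
InSp g ℓ Λ = ((transpose Λ ⊛ Ω g) ⊕ (Ω g ⊛ Λ)) ≡M zeroMat [mod ℓ ]

⟦_,_⟧ : ∀ {n} → Mat n → Mat n → Mat n
⟦ X , Y ⟧ = (X ⊛ Y) ⊖ (Y ⊛ X)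

combo : ∀ {n} → List (ℤ × Mat n × Mat n) → Mat n
combo = foldr (λ { (c , X , Y) acc → (c · ⟦ X , Y ⟧) ⊕ acc }) zeroMat

InBracketGsp : (g ℓ : ℕ) → Mat (g ℕ.+ g) → Set
InBracketGsp g ℓ M =
  Σ (List (ℤ × Mat (g ℕ.+ g) × Mat (g ℕ.+ g))) λ ts →
    All (λ t → InGsp g ℓ (proj₁ (proj₂ t)) × InGsp g ℓ (proj₂ (proj₂ t))) ts
    × (M ≡M combo ts [mod ℓ ])

module Submission where

-- [gsp_2g, gsp_2g] = sp_2g over ℤ/ℓℤ.  Write  defect X = Xᵀ Ω + Ω X,  so
-- X ∈ gsp iff defect X ≡ d Ω for a multiplier d, and X ∈ sp iff defect X ≡ 0.
--
-- (⊆) The defect obeys a Leibniz rule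
--       defect [X, Y] = (Yᵀ·defect X + defect X·Y) − (Xᵀ·defect Y + defect Y·X),
--     which for multipliers d, e gives d e Ω − e d Ω = 0; by linearity every
--     combination of commutators has vanishing defect (any W, any modulus).
-- (⊇) For M = [[A, B], [C, −Aᵀ]] ∈ sp we write M as a sum of commutators of
--     elements of gsp: [D, [D, M]] with D = diag(I, 0) gives the blocks B, C;
--     A_cc [E_{Lc,Rc}, E_{Rc,Lc}] the diagonals of A and −Aᵀ; and
--     [diag(E_cc, −E_cc), embed(E_cc A)] the rest of row c of A, where
--     embed P = [[P, 0], [0, −Pᵀ]].  Membership in gsp is read off from blocks.
--
-- Order: congruences, sums and δ; matrix algebra and the defect; the block
-- structure of Ω; the decomposition.

open import Defs
open import Data.Nat using (ℕ; zero; suc; _<_)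
import Data.Nat as ℕ
import Data.Nat.Properties as ℕP
open import Data.Nat.Primality using (Prime)
import Data.Integer as Int
open import Data.Integer using (ℤ; _+_; _*_; -_; _-_; 0ℤ; 1ℤ; -1ℤ)
import Data.Integer.Properties as ℤP
import Data.Integer.Divisibility.Signed as Signed
open import Data.Integer.Tactic.RingSolver using (solve-∀)
open import Data.Fin as F using (Fin; zero; suc; toℕ; _↑ˡ_; _↑ʳ_)
import Data.Fin.Properties as FP
import Data.Vec.Functional as Vec
open import Data.Vec.Functional.Properties using (lookup-++ˡ; lookup-++ʳ)
open import Data.List using (List; []; _∷_; _++_; tabulate)
import Data.List.Relation.Unary.All as All
open import Data.List.Relation.Unary.All using (All; []; _∷_)
open import Data.List.Relation.Unary.All.Properties using (++⁺; tabulate⁺)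
open import Data.Product using (Σ; _×_; _,_; proj₁; proj₂)
open import Data.Empty using (⊥-elim)
open import Function using (_∘_)
open import Relation.Binary.PropositionalEquality
open import Relation.Nullary using (yes; no)
open import Algebra.Properties.Semiring.Sum ℤP.+-*-semiring
  using (sum; sum-cong-≗; ∑-distrib-+; ∑-comm; *-distribˡ-sum; sum-replicate-zero)

-- Congruence modulo a fixed integer k.  It is a record so that its two
-- sides can be inferred from a proof.
module Congruence (k : ℤ) where

  infix 4 _≈_
  record _≈_ (x y : ℤ) : Set where
    constructor mod
    field divides : k Signed.∣ (x - y)
  open _≈_ public

  -- Every compatibility property below follows the same pattern: the
  -- difference of the two sides is a known multiple of k.
  ≈-via : ∀ {x y} d → k Signed.∣ d → d ≡ x - y → x ≈ y
  ≈-via d k∣d refl = mod k∣d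

  ≈-reflexive : ∀ {x y} → x ≡ y → x ≈ y
  ≈-reflexive {x} refl = ≈-via 0ℤ (Signed.divides 0ℤ (sym (ℤP.*-zeroˡ k))) (sym (ℤP.+-inverseʳ x))

  ≈-refl : ∀ {x} → x ≈ x
  ≈-refl = ≈-reflexive refl

  ≈-trans : ∀ {x y z} → x ≈ y → y ≈ z → x ≈ z
  ≈-trans {x} {y} {z} (mod p) (mod q) = ≈-via _ (Signed.∣m∣n⇒∣m+n p q) (difference x y z)
    where difference : ∀ x y z → (x - y) + (y - z) ≡ x - z
          difference = solve-∀

  +-cong : ∀ {x y u v} → x ≈ y → u ≈ v → x + u ≈ y + v
  +-cong {x} {y} {u} {v} (mod p) (mod q) = ≈-via _ (Signed.∣m∣n⇒∣m+n p q) (difference x y u v)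
    where difference : ∀ x y u v → (x - y) + (u - v) ≡ (x + u) - (y + v)
          difference = solve-∀

  -‿cong : ∀ {x y} → x ≈ y → - x ≈ - y
  -‿cong {x} {y} (mod p) = ≈-via _ (Signed.∣m⇒∣-m p) (difference x y)
    where difference : ∀ x y → - (x - y) ≡ (- x) - (- y)
          difference = solve-∀

  *-congˡ : ∀ c {x y} → x ≈ y → c * x ≈ c * y
  *-congˡ c {x} {y} (mod p) = ≈-via _ (Signed.∣n⇒∣m*n c p) (difference c x y)
    where difference : ∀ c x y → c * (x - y) ≡ c * x - c * y
          difference = solve-∀

  *-congʳ : ∀ c {x y} → x ≈ y → x * c ≈ y * c
  *-congʳ c {x} {y} x≈y = subst₂ _≈_ (ℤP.*-comm c x) (ℤP.*-comm c y) (*-congˡ c x≈y)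

  ≈-neg-of-sum : ∀ {x y} → x + y ≈ 0ℤ → y ≈ - x
  ≈-neg-of-sum {x} {y} (mod p) = ≈-via _ p (difference x y)
    where difference : ∀ x y → (x + y) - 0ℤ ≡ y - (- x)
          difference = solve-∀

  Σ-cong≈ : ∀ {n} {f h : Fin n → ℤ} → (∀ i → f i ≈ h i) → Σfin f ≈ Σfin h
  Σ-cong≈ {zero}  f≈h = ≈-refl
  Σ-cong≈ {suc n} f≈h = +-cong (f≈h zero) (Σ-cong≈ (λ i → f≈h (suc i)))

-- The sum Σfin of the definitions is the library's finite sum over the
-- semiring ℤ, so the standard summation laws transfer to it.
Σfin≡sum : ∀ {n} (f : Fin n → ℤ) → Σfin f ≡ sum f
Σfin≡sum {zero}  f = refl
Σfin≡sum {suc n} f = cong (_+_ (f zero)) (Σfin≡sum (λ i → f (suc i)))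

Σ-cong : ∀ {n} {f h : Fin n → ℤ} → (∀ i → f i ≡ h i) → Σfin f ≡ Σfin h
Σ-cong {f = f} {h} f≗h = trans (Σfin≡sum f) (trans (sum-cong-≗ f≗h) (sym (Σfin≡sum h)))

Σ-+ : ∀ {n} (f h : Fin n → ℤ) → Σfin (λ i → f i + h i) ≡ Σfin f + Σfin h
Σ-+ f h = begin
  Σfin (λ i → f i + h i)  ≡⟨ Σfin≡sum (λ i → f i + h i) ⟩
  sum (λ i → f i + h i)   ≡⟨ ∑-distrib-+ f h ⟩
  sum f + sum h           ≡⟨ sym (cong₂ _+_ (Σfin≡sum f) (Σfin≡sum h)) ⟩
  Σfin f + Σfin h         ∎
  where open ≡-Reasoning

Σ-*ˡ : ∀ {n} c (f : Fin n → ℤ) → Σfin (λ i → c * f i) ≡ c * Σfin f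
Σ-*ˡ c f = begin
  Σfin (λ i → c * f i)  ≡⟨ Σfin≡sum (λ i → c * f i) ⟩
  sum (λ i → c * f i)   ≡⟨ sym (*-distribˡ-sum c f) ⟩
  c * sum f             ≡⟨ sym (cong (c *_) (Σfin≡sum f)) ⟩
  c * Σfin f            ∎
  where open ≡-Reasoning

Σ-*ʳ : ∀ {n} c (f : Fin n → ℤ) → Σfin (λ i → f i * c) ≡ Σfin f * c
Σ-*ʳ c f = trans (Σ-cong (λ i → ℤP.*-comm (f i) c)) (trans (Σ-*ˡ c f) (ℤP.*-comm c _))

Σ-zero : ∀ {n} → Σfin {n} (λ _ → 0ℤ) ≡ 0ℤ
Σ-zero {n} = trans (Σfin≡sum {n} (λ _ → 0ℤ)) (sum-replicate-zero n)

Σ-neg : ∀ {n} (f : Fin n → ℤ) → Σfin (λ i → - f i) ≡ - Σfin f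
Σ-neg f = begin
  Σfin (λ i → - f i)       ≡⟨ Σ-cong (λ i → sym (ℤP.-1*i≡-i (f i))) ⟩
  Σfin (λ i → -1ℤ * f i)   ≡⟨ Σ-*ˡ -1ℤ f ⟩
  -1ℤ * Σfin f             ≡⟨ ℤP.-1*i≡-i _ ⟩
  - Σfin f                 ∎
  where open ≡-Reasoning

Σ-- : ∀ {n} (f h : Fin n → ℤ) → Σfin (λ i → f i - h i) ≡ Σfin f - Σfin h
Σ-- f h = trans (Σ-+ f (λ i → - h i)) (cong (_+_ (Σfin f)) (Σ-neg h))

Σ-swap : ∀ {m n} (f : Fin m → Fin n → ℤ) →
         Σfin (λ i → Σfin (λ j → f i j)) ≡ Σfin (λ j → Σfin (λ i → f i j))
Σ-swap f = begin
  Σfin (λ i → Σfin (λ j → f i j))  ≡⟨ trans (Σ-cong (λ i → Σfin≡sum (f i))) (Σfin≡sum (λ i → sum (f i))) ⟩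
  sum (λ i → sum (λ j → f i j))    ≡⟨ ∑-comm f ⟩
  sum (λ j → sum (λ i → f i j))    ≡⟨ sym (trans (Σ-cong (λ j → Σfin≡sum (λ i → f i j))) (Σfin≡sum (λ j → sum (λ i → f i j)))) ⟩
  Σfin (λ j → Σfin (λ i → f i j))  ∎
  where open ≡-Reasoning

-- The Kronecker delta, by recursion so that δ (suc i) (suc j) = δ i j.
δ : ∀ {n} → Fin n → Fin n → ℤ
δ zero    zero    = 1ℤ
δ zero    (suc _) = 0ℤ
δ (suc _) zero    = 0ℤ
δ (suc i) (suc j) = δ i j

δ-refl : ∀ {n} (i : Fin n) → δ i i ≡ 1ℤ
δ-refl zero    = refl
δ-refl (suc i) = δ-refl i

δ-sym : ∀ {n} (i j : Fin n) → δ i j ≡ δ j i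
δ-sym zero    zero    = refl
δ-sym zero    (suc j) = refl
δ-sym (suc i) zero    = refl
δ-sym (suc i) (suc j) = δ-sym i j

Σ-δ : ∀ {n} (i : Fin n) (f : Fin n → ℤ) → Σfin (λ j → δ i j * f j) ≡ f i
Σ-δ {suc n} zero f = begin
  1ℤ * f zero + Σfin (λ j → 0ℤ * f (suc j))  ≡⟨ cong₂ _+_ (ℤP.*-identityˡ (f zero)) (Σ-cong {n} (λ j → ℤP.*-zeroˡ (f (suc j)))) ⟩
  f zero + Σfin {n} (λ _ → 0ℤ)               ≡⟨ cong (_+_ (f zero)) (Σ-zero {n}) ⟩
  f zero + 0ℤ                                ≡⟨ ℤP.+-identityʳ _ ⟩
  f zero                                     ∎
  where open ≡-Reasoning
Σ-δ {suc n} (suc i) f = trans (ℤP.+-identityˡ _) (Σ-δ i (λ j → f (suc j)))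

Σ-δʳ : ∀ {n} (i : Fin n) (f : Fin n → ℤ) → Σfin (λ j → f j * δ j i) ≡ f i
Σ-δʳ i f = trans (Σ-cong (λ j → trans (ℤP.*-comm (f j) _) (cong (_* f j) (δ-sym j i)))) (Σ-δ i f)

δ-≢ : ∀ {n} {i j : Fin n} → i ≢ j → δ i j ≡ 0ℤ
δ-≢ {i = zero}  {zero}  i≢j = ⊥-elim (i≢j refl)
δ-≢ {i = zero}  {suc j} i≢j = refl
δ-≢ {i = suc i} {zero}  i≢j = refl
δ-≢ {i = suc i} {suc j} i≢j = δ-≢ (i≢j ∘ cong suc)

δ-transport : ∀ {n} (f : Fin n → ℤ) (a b : Fin n) → f a * δ a b ≡ f b * δ a b
δ-transport f zero    zero    = refl
δ-transport f zero    (suc b) = trans (ℤP.*-zeroʳ (f zero)) (sym (ℤP.*-zeroʳ (f (suc b))))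
δ-transport f (suc a) zero    = trans (ℤP.*-zeroʳ (f (suc a))) (sym (ℤP.*-zeroʳ (f zero)))
δ-transport f (suc a) (suc b) = δ-transport (λ i → f (suc i)) a b

δδ-sym : ∀ {n} (a b c : Fin n) → δ a c * δ c b ≡ δ b c * δ c a
δδ-sym a b c = trans (ℤP.*-comm (δ a c) (δ c b)) (cong₂ _*_ (δ-sym c b) (δ-sym a c))

select : ∀ {n} (p q : Fin n) (x y : ℤ) → (p ≡ q → x ≡ y) → x * δ p q + (1ℤ - δ p q) * y ≡ y
select p q x y p≡q⇒x≡y with p F.≟ q
... | yes refl = begin
  x * δ p p + (1ℤ - δ p p) * y ≡⟨ cong (λ e → x * e + (1ℤ - e) * y) (δ-refl p) ⟩
  x * 1ℤ + (1ℤ - 1ℤ) * y       ≡⟨ ring x y ⟩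
  x                            ≡⟨ p≡q⇒x≡y refl ⟩
  y                            ∎
  where open ≡-Reasoning
        ring : ∀ x y → x * 1ℤ + (1ℤ - 1ℤ) * y ≡ x
        ring = solve-∀
... | no p≢q = trans (cong (λ e → x * e + (1ℤ - e) * y) (δ-≢ p≢q)) (ring x y)
  where ring : ∀ x y → x * 0ℤ + (1ℤ - 0ℤ) * y ≡ y
        ring = solve-∀

-- Exact (entrywise) equality of integer matrices; the matrix identities
-- below hold over ℤ, before reducing modulo anything.
infix 4 _≐_
_≐_ : ∀ {n} → Mat n → Mat n → Set
A ≐ B = ∀ i j → A i j ≡ B i j

module _ {n : ℕ} where

  ⊛-cong : {A A′ B B′ : Mat n} → A ≐ A′ → B ≐ B′ → A ⊛ B ≐ A′ ⊛ B′
  ⊛-cong A≐A′ B≐B′ i j = Σ-cong {n} (λ k → cong₂ _*_ (A≐A′ i k) (B≐B′ k j))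

  ⊛-distribˡ-⊕ : (A B C : Mat n) → A ⊛ (B ⊕ C) ≐ (A ⊛ B) ⊕ (A ⊛ C)
  ⊛-distribˡ-⊕ A B C i j =
    trans (Σ-cong {n} (λ k → ℤP.*-distribˡ-+ (A i k) (B k j) (C k j))) (Σ-+ (λ k → A i k * B k j) (λ k → A i k * C k j))

  ⊛-distribʳ-⊕ : (A B C : Mat n) → (B ⊕ C) ⊛ A ≐ (B ⊛ A) ⊕ (C ⊛ A)
  ⊛-distribʳ-⊕ A B C i j =
    trans (Σ-cong {n} (λ k → ℤP.*-distribʳ-+ (A k j) (B i k) (C i k))) (Σ-+ (λ k → B i k * A k j) (λ k → C i k * A k j))

  ⊛-distribˡ-⊖ : (A B C : Mat n) → A ⊛ (B ⊖ C) ≐ (A ⊛ B) ⊖ (A ⊛ C)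
  ⊛-distribˡ-⊖ A B C i j = trans (Σ-cong {n} (λ k → ring (A i k) (B k j) (C k j))) (Σ-- (λ k → A i k * B k j) (λ k → A i k * C k j))
    where ring : ∀ a b c → a * (b - c) ≡ a * b - a * c
          ring = solve-∀

  ⊛-distribʳ-⊖ : (A B C : Mat n) → (B ⊖ C) ⊛ A ≐ (B ⊛ A) ⊖ (C ⊛ A)
  ⊛-distribʳ-⊖ A B C i j = trans (Σ-cong {n} (λ k → ring (A k j) (B i k) (C i k))) (Σ-- (λ k → B i k * A k j) (λ k → C i k * A k j))
    where ring : ∀ a b c → (b - c) * a ≡ b * a - c * a
          ring = solve-∀

  ⊛-scalarˡ : (c : ℤ) (A B : Mat n) → (c · A) ⊛ B ≐ c · (A ⊛ B)
  ⊛-scalarˡ c A B i j = trans (Σ-cong {n} (λ k → ℤP.*-assoc c (A i k) (B k j))) (Σ-*ˡ c (λ k → A i k * B k j))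

  ⊛-scalarʳ : (c : ℤ) (A B : Mat n) → A ⊛ (c · B) ≐ c · (A ⊛ B)
  ⊛-scalarʳ c A B i j = trans (Σ-cong {n} (λ k → ring (A i k) c (B k j))) (Σ-*ˡ c (λ k → A i k * B k j))
    where ring : ∀ a c b → a * (c * b) ≡ c * (a * b)
          ring = solve-∀

  ⊛-zeroˡ : (A : Mat n) → zeroMat ⊛ A ≐ zeroMat
  ⊛-zeroˡ A i j = trans (Σ-cong {n} (λ k → ℤP.*-zeroˡ (A k j))) (Σ-zero {n})

  ⊛-zeroʳ : (A : Mat n) → A ⊛ zeroMat ≐ zeroMat
  ⊛-zeroʳ A i j = trans (Σ-cong {n} (λ k → ℤP.*-zeroʳ (A i k))) (Σ-zero {n})

  ⊛-assoc : (A B C : Mat n) → (A ⊛ B) ⊛ C ≐ A ⊛ (B ⊛ C)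
  ⊛-assoc A B C i j = begin
    Σfin (λ k → Σfin (λ m → A i m * B m k) * C k j)  ≡⟨ Σ-cong {n} (λ k → sym (Σ-*ʳ (C k j) (λ m → A i m * B m k))) ⟩
    Σfin (λ k → Σfin (λ m → A i m * B m k * C k j))  ≡⟨ Σ-swap (λ k m → A i m * B m k * C k j) ⟩
    Σfin (λ m → Σfin (λ k → A i m * B m k * C k j))  ≡⟨ Σ-cong {n} (λ m → Σ-cong {n} (λ k → ℤP.*-assoc (A i m) _ _)) ⟩
    Σfin (λ m → Σfin (λ k → A i m * (B m k * C k j))) ≡⟨ Σ-cong {n} (λ m → Σ-*ˡ (A i m) (λ k → B m k * C k j)) ⟩
    Σfin (λ m → A i m * Σfin (λ k → B m k * C k j))  ∎
    where open ≡-Reasoning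

  transpose-⊛ : (A B : Mat n) → transpose (A ⊛ B) ≐ transpose B ⊛ transpose A
  transpose-⊛ A B i j = Σ-cong {n} (λ k → ℤP.*-comm (A j k) (B k i))

module Defect {n : ℕ} (W : Mat n) where

  defect : Mat n → Mat n
  defect X = (transpose X ⊛ W) ⊕ (W ⊛ X)

  defect-⊕ : (A B : Mat n) → defect (A ⊕ B) ≐ defect A ⊕ defect B
  defect-⊕ A B i j = trans
    (cong₂ _+_ (⊛-distribʳ-⊕ W (transpose A) (transpose B) i j) (⊛-distribˡ-⊕ W A B i j))
    (ring ((transpose A ⊛ W) i j) ((transpose B ⊛ W) i j) ((W ⊛ A) i j) ((W ⊛ B) i j))
    where ring : ∀ a b c d → (a + b) + (c + d) ≡ (a + c) + (b + d)
          ring = solve-∀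

  defect-· : (c : ℤ) (A : Mat n) → defect (c · A) ≐ c · defect A
  defect-· c A i j = trans
    (cong₂ _+_ (⊛-scalarˡ c (transpose A) W i j) (⊛-scalarʳ c W A i j))
    (sym (ℤP.*-distribˡ-+ c _ _))

  defect-zero : defect zeroMat ≐ zeroMat
  defect-zero i j = cong₂ _+_ (⊛-zeroˡ W i j) (⊛-zeroʳ W i j)

  defect-⟦⟧ : (X Y : Mat n) →
    defect ⟦ X , Y ⟧ ≐ ((transpose Y ⊛ defect X) ⊕ (defect X ⊛ Y))
                        ⊖ ((transpose X ⊛ defect Y) ⊕ (defect Y ⊛ X))
  defect-⟦⟧ X Y i j = trans expandˡ (trans (ring a b c e p q) (sym expandʳ))
    where
    Xᵀ = transpose X
    Yᵀ = transpose Y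
    a = (Yᵀ ⊛ (Xᵀ ⊛ W)) i j
    b = (Xᵀ ⊛ (Yᵀ ⊛ W)) i j
    c = ((W ⊛ X) ⊛ Y) i j
    e = ((W ⊛ Y) ⊛ X) i j
    p = (Yᵀ ⊛ (W ⊛ X)) i j
    q = (Xᵀ ⊛ (W ⊛ Y)) i j
    ring : ∀ a b c e p q → (a - b) + (c - e) ≡ ((a + p) + (q + c)) - ((b + q) + (p + e))
    ring = solve-∀
    open ≡-Reasoning
    expandˡ : defect ⟦ X , Y ⟧ i j ≡ (a - b) + (c - e)
    expandˡ = cong₂ _+_
      (begin
        (transpose ⟦ X , Y ⟧ ⊛ W) i j
          ≡⟨ ⊛-distribʳ-⊖ W (transpose (X ⊛ Y)) (transpose (Y ⊛ X)) i j ⟩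
        (transpose (X ⊛ Y) ⊛ W) i j - (transpose (Y ⊛ X) ⊛ W) i j
          ≡⟨ cong₂ _-_ (trans (⊛-cong {B = W} (transpose-⊛ X Y) (λ _ _ → refl) i j) (⊛-assoc Yᵀ Xᵀ W i j))
                       (trans (⊛-cong {B = W} (transpose-⊛ Y X) (λ _ _ → refl) i j) (⊛-assoc Xᵀ Yᵀ W i j)) ⟩
        a - b ∎)
      (begin
        (W ⊛ ⟦ X , Y ⟧) i j                 ≡⟨ ⊛-distribˡ-⊖ W (X ⊛ Y) (Y ⊛ X) i j ⟩
        (W ⊛ (X ⊛ Y)) i j - (W ⊛ (Y ⊛ X)) i j ≡⟨ sym (cong₂ _-_ (⊛-assoc W X Y i j) (⊛-assoc W Y X i j)) ⟩
        c - e ∎)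
    expand : (X Y : Mat n) → ((transpose Y ⊛ defect X) ⊕ (defect X ⊛ Y)) i j ≡
      ((transpose Y ⊛ (transpose X ⊛ W)) i j + (transpose Y ⊛ (W ⊛ X)) i j)
      + ((transpose X ⊛ (W ⊛ Y)) i j + ((W ⊛ X) ⊛ Y) i j)
    expand X Y = cong₂ _+_
      (⊛-distribˡ-⊕ (transpose Y) (transpose X ⊛ W) (W ⊛ X) i j)
      (trans (⊛-distribʳ-⊕ Y (transpose X ⊛ W) (W ⊛ X) i j)
             (cong (_+ ((W ⊛ X) ⊛ Y) i j) (⊛-assoc (transpose X) W Y i j)))
    expandʳ : (((Yᵀ ⊛ defect X) ⊕ (defect X ⊛ Y)) ⊖ ((Xᵀ ⊛ defect Y) ⊕ (defect Y ⊛ X))) i j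
              ≡ ((a + p) + (q + c)) - ((b + q) + (p + e))
    expandʳ = cong₂ _-_ (expand X Y) (expand Y X)

  module Modulo (k : ℤ) where
    open Congruence k

    infix 4 _≈ₘ_
    _≈ₘ_ : Mat n → Mat n → Set
    A ≈ₘ B = ∀ i j → A i j ≈ B i j

    ⊛-congˡ≈ : {A A′ : Mat n} (B : Mat n) → A ≈ₘ A′ → A ⊛ B ≈ₘ A′ ⊛ B
    ⊛-congˡ≈ B A≈A′ i j = Σ-cong≈ (λ m → *-congʳ (B m j) (A≈A′ i m))

    ⊛-congʳ≈ : (B : Mat n) {A A′ : Mat n} → A ≈ₘ A′ → B ⊛ A ≈ₘ B ⊛ A′
    ⊛-congʳ≈ B A≈A′ i j = Σ-cong≈ (λ m → *-congˡ (B i m) (A≈A′ m j))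

    defect-cong≈ : {A B : Mat n} → A ≈ₘ B → defect A ≈ₘ defect B
    defect-cong≈ A≈B i j = +-cong (⊛-congˡ≈ W (λ a b → A≈B b a) i j) (⊛-congʳ≈ W A≈B i j)

    HasMultiplier : Mat n → ℤ → Set
    HasMultiplier X d = defect X ≈ₘ (d · W)

    -- If defect X ≡ d W then Yᵀ (defect X) + (defect X) Y ≡ d · defect Y ≡ d e W.
    leibniz-term : (X Y : Mat n) (d e : ℤ) → HasMultiplier X d → HasMultiplier Y e →
      ∀ i j → ((transpose Y ⊛ defect X) ⊕ (defect X ⊛ Y)) i j ≈ d * (e * W i j)
    leibniz-term X Y d e hX hY i j = ≈-trans
      (+-cong (⊛-congʳ≈ (transpose Y) hX i j) (⊛-congˡ≈ Y hX i j))
      (≈-trans (≈-reflexive (trans (cong₂ _+_ (⊛-scalarʳ d (transpose Y) W i j) (⊛-scalarˡ d W Y i j))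
                                   (sym (ℤP.*-distribˡ-+ d _ _))))
               (*-congˡ d (hY i j)))

    -- [gsp, gsp] ⊆ sp for a single commutator: d e W − e d W = 0.
    defect-⟦⟧≈0 : (X Y : Mat n) (d e : ℤ) → HasMultiplier X d → HasMultiplier Y e →
      defect ⟦ X , Y ⟧ ≈ₘ zeroMat
    defect-⟦⟧≈0 X Y d e hX hY i j = subst (_≈ 0ℤ) (sym (defect-⟦⟧ X Y i j))
      (≈-trans (+-cong (leibniz-term X Y d e hX hY i j) (-‿cong (leibniz-term Y X e d hY hX i j)))
               (≈-reflexive (ring d e (W i j))))
      where ring : ∀ d e w → d * (e * w) + - (e * (d * w)) ≡ 0ℤ
            ring = solve-∀

    defect-combo≈0 : (ts : List (ℤ × Mat n × Mat n)) →
      All (λ t → Σ ℤ (HasMultiplier (proj₁ (proj₂ t))) × Σ ℤ (HasMultiplier (proj₂ (proj₂ t)))) ts →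
      defect (combo ts) ≈ₘ zeroMat
    defect-combo≈0 [] [] i j = ≈-reflexive (defect-zero i j)
    defect-combo≈0 ((c , X , Y) ∷ ts) (((d , hX) , (e , hY)) ∷ hs) i j =
      subst (_≈ 0ℤ) (sym (trans (defect-⊕ (c · ⟦ X , Y ⟧) (combo ts) i j)
                                (cong (_+ defect (combo ts) i j) (defect-· c ⟦ X , Y ⟧ i j))))
        (≈-trans (+-cong (*-congˡ c (defect-⟦⟧≈0 X Y d e hX hY i j)) (defect-combo≈0 ts hs i j))
                 (≈-reflexive (trans (ℤP.+-identityʳ _) (ℤP.*-zeroʳ c))))

diag : ∀ {n} → (Fin n → ℤ) → Mat n
diag w i j = w i * δ i j

unit : ∀ {n} → Fin n → Fin n → Mat n
unit p q i j = δ i p * δ q j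

⟦diag⟧ : ∀ {n} (w : Fin n → ℤ) (Y : Mat n) → ∀ i j → ⟦ diag w , Y ⟧ i j ≡ (w i - w j) * Y i j
⟦diag⟧ w Y i j = trans (cong₂ _-_ left-mult right-mult) (factor (w i) (w j) (Y i j))
  where
  factor : ∀ a b y → a * y - y * b ≡ (a - b) * y
  factor = solve-∀
  left-mult : (diag w ⊛ Y) i j ≡ w i * Y i j
  left-mult = trans (Σ-cong (λ k → ring (w i) (δ i k) (Y k j))) (Σ-δ i (λ k → w i * Y k j))
    where ring : ∀ a b c → a * b * c ≡ b * (a * c)
          ring = solve-∀
  right-mult : (Y ⊛ diag w) i j ≡ Y i j * w j
  right-mult = trans (Σ-cong (λ k → sym (ℤP.*-assoc (Y i k) (w k) (δ k j)))) (Σ-δʳ j (λ k → Y i k * w k))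

⟦unit⟧ : ∀ {n} (p q : Fin n) → ∀ i j → ⟦ unit p q , unit q p ⟧ i j ≡ δ i p * δ p j - δ i q * δ q j
⟦unit⟧ p q i j = cong₂ _-_ (unit-mult p q) (unit-mult q p)
  where
  unit-mult : ∀ p q → (unit p q ⊛ unit q p) i j ≡ δ i p * δ p j
  unit-mult p q = begin
    Σfin (λ k → δ i p * δ q k * (δ k q * δ p j)) ≡⟨ Σ-cong (λ k → ring (δ i p) (δ q k) (δ k q) (δ p j)) ⟩
    Σfin (λ k → δ q k * (δ k q * (δ i p * δ p j))) ≡⟨ Σ-δ q (λ k → δ k q * (δ i p * δ p j)) ⟩
    δ q q * (δ i p * δ p j)                        ≡⟨ cong (_* (δ i p * δ p j)) (δ-refl q) ⟩
    1ℤ * (δ i p * δ p j)                           ≡⟨ ℤP.*-identityˡ _ ⟩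
    δ i p * δ p j                                  ∎
    where open ≡-Reasoning
          ring : ∀ a b c d → a * b * (c * d) ≡ b * (c * (a * d))
          ring = solve-∀

termMat : ∀ {n} → ℤ × Mat n × Mat n → Mat n
termMat (c , X , Y) = c · ⟦ X , Y ⟧

combo-++ : ∀ {n} (xs ys : List (ℤ × Mat n × Mat n)) → combo (xs ++ ys) ≐ combo xs ⊕ combo ys
combo-++ []       ys i j = sym (ℤP.+-identityˡ _)
combo-++ (x ∷ xs) ys i j = trans (cong (termMat x i j +_) (combo-++ xs ys i j)) (sym (ℤP.+-assoc (termMat x i j) _ _))

combo-tabulate : ∀ {n m} (f : Fin m → ℤ × Mat n × Mat n) →
  combo (tabulate f) ≐ λ i j → Σfin (λ c → termMat (f c) i j)
combo-tabulate {m = zero}  f i j = refl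
combo-tabulate {m = suc m} f i j = cong (termMat (f zero) i j +_) (combo-tabulate (λ c → f (suc c)) i j)

data Split (m n : ℕ) : Fin (m ℕ.+ n) → Set where
  left  : (a : Fin m) → Split m n (a ↑ˡ n)
  right : (b : Fin n) → Split m n (m ↑ʳ b)

split : ∀ m {n} (i : Fin (m ℕ.+ n)) → Split m n i
split zero    i       = right i
split (suc m) zero    = left zero
split (suc m) (suc i) with split m i
... | left a  = left (suc a)
... | right b = right b

δ-↑ˡ : ∀ {m} n (a b : Fin m) → δ (a ↑ˡ n) (b ↑ˡ n) ≡ δ a b
δ-↑ˡ n zero    zero    = refl
δ-↑ˡ n zero    (suc b) = refl
δ-↑ˡ n (suc a) zero    = refl
δ-↑ˡ n (suc a) (suc b) = δ-↑ˡ n a b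

δ-↑ʳ : ∀ m {n} (a b : Fin n) → δ (m ↑ʳ a) (m ↑ʳ b) ≡ δ a b
δ-↑ʳ zero    a b = refl
δ-↑ʳ (suc m) a b = δ-↑ʳ m a b

δ-↑ˡ↑ʳ : ∀ {m n} (a : Fin m) (b : Fin n) → δ (a ↑ˡ n) (m ↑ʳ b) ≡ 0ℤ
δ-↑ˡ↑ʳ zero    b = refl
δ-↑ˡ↑ʳ (suc a) b = δ-↑ˡ↑ʳ a b

δ-↑ʳ↑ˡ : ∀ {m n} (b : Fin n) (a : Fin m) → δ (m ↑ʳ b) (a ↑ˡ n) ≡ 0ℤ
δ-↑ʳ↑ˡ {m} {n} b a = trans (δ-sym (m ↑ʳ b) (a ↑ˡ n)) (δ-↑ˡ↑ʳ a b)

module Blocks (g : ℕ) where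

  L R : Fin g → Fin (g ℕ.+ g)
  L a = a ↑ˡ g
  R b = g ↑ʳ b

  by-blocks : {P : Fin (g ℕ.+ g) → Fin (g ℕ.+ g) → Set} →
    (∀ a b → P (L a) (L b)) → (∀ a b → P (L a) (R b)) →
    (∀ a b → P (R a) (L b)) → (∀ a b → P (R a) (R b)) → ∀ i j → P i j
  by-blocks {P} LL LR RL RR i j with split g i | split g j
  ... | left a  | left b  = LL a b
  ... | left a  | right b = LR a b
  ... | right a | left b  = RL a b
  ... | right a | right b = RR a b

  -- The Gram matrix Ω g = [[0, I], [−I, 0]] in blocks.  Its definition
  -- compares positions, so the block values need a little arithmetic.
  private
    Ω-zero : ∀ {i j} → toℕ j ≢ toℕ i ℕ.+ g → toℕ i ≢ toℕ j ℕ.+ g → Ω g i j ≡ 0ℤ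
    Ω-zero {i} {j} ne₁ ne₂ with toℕ j ℕ.≟ toℕ i ℕ.+ g | toℕ i ℕ.≟ toℕ j ℕ.+ g
    ... | yes e | _     = ⊥-elim (ne₁ e)
    ... | no _  | yes e = ⊥-elim (ne₂ e)
    ... | no _  | no _  = refl

    Ω-one : ∀ {i j} → toℕ j ≡ toℕ i ℕ.+ g → Ω g i j ≡ 1ℤ
    Ω-one {i} {j} e with toℕ j ℕ.≟ toℕ i ℕ.+ g
    ... | yes _ = refl
    ... | no ne = ⊥-elim (ne e)

    Ω-minus-one : ∀ {i j} → toℕ j ≢ toℕ i ℕ.+ g → toℕ i ≡ toℕ j ℕ.+ g → Ω g i j ≡ -1ℤ
    Ω-minus-one {i} {j} ne e with toℕ j ℕ.≟ toℕ i ℕ.+ g | toℕ i ℕ.≟ toℕ j ℕ.+ g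
    ... | yes e′ | _      = ⊥-elim (ne e′)
    ... | no _   | yes _  = refl
    ... | no _   | no ne′ = ⊥-elim (ne′ e)

    L-below : ∀ a x → toℕ (L a) ≢ x ℕ.+ g
    L-below a x e = ℕP.m+n≮n x g (subst (ℕ._< g) (trans (sym (FP.toℕ-↑ˡ a g)) e) (FP.toℕ<n a))

    R-beyond : ∀ (i : Fin (g ℕ.+ g)) b → toℕ i ≢ toℕ (R b) ℕ.+ g
    R-beyond i b e = ℕP.<⇒≢ (ℕP.<-≤-trans (FP.toℕ<n i) g+g≤) e
      where g+g≤ : g ℕ.+ g ℕ.≤ toℕ (R b) ℕ.+ g
            g+g≤ = ℕP.+-monoˡ-≤ g (subst (g ℕ.≤_) (sym (FP.toℕ-↑ʳ g b)) (ℕP.m≤m+n g (toℕ b)))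

    R≡L+g : ∀ a b → toℕ (R b) ≡ toℕ (L a) ℕ.+ g → a ≡ b
    R≡L+g a b e = FP.toℕ-injective (sym (ℕP.+-cancelˡ-≡ g _ _ (begin
      g ℕ.+ toℕ b      ≡⟨ sym (FP.toℕ-↑ʳ g b) ⟩
      toℕ (R b)        ≡⟨ e ⟩
      toℕ (L a) ℕ.+ g  ≡⟨ cong (ℕ._+ g) (FP.toℕ-↑ˡ a g) ⟩
      toℕ a ℕ.+ g      ≡⟨ ℕP.+-comm (toℕ a) g ⟩
      g ℕ.+ toℕ a      ∎)))
      where open ≡-Reasoning

    L+g≡R : ∀ a → toℕ (R a) ≡ toℕ (L a) ℕ.+ g
    L+g≡R a = trans (FP.toℕ-↑ʳ g a) (trans (ℕP.+-comm g (toℕ a)) (cong (ℕ._+ g) (sym (FP.toℕ-↑ˡ a g))))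

  Ω-LL : ∀ a b → Ω g (L a) (L b) ≡ 0ℤ
  Ω-LL a b = Ω-zero (L-below b _) (L-below a _)

  Ω-LR : ∀ a b → Ω g (L a) (R b) ≡ δ a b
  Ω-LR a b with a F.≟ b
  ... | yes refl = trans (Ω-one (L+g≡R a)) (sym (δ-refl a))
  ... | no a≢b   = trans (Ω-zero (a≢b ∘ R≡L+g a b) (L-below a _)) (sym (δ-≢ a≢b))

  Ω-RL : ∀ a b → Ω g (R a) (L b) ≡ - δ a b
  Ω-RL a b with a F.≟ b
  ... | yes refl = trans (Ω-minus-one (L-below a _) (L+g≡R a)) (cong -_ (sym (δ-refl a)))
  ... | no a≢b   = trans (Ω-zero (L-below b _) (a≢b ∘ sym ∘ R≡L+g b a)) (cong -_ (sym (δ-≢ a≢b)))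

  Ω-RR : ∀ a b → Ω g (R a) (R b) ≡ 0ℤ
  Ω-RR a b = Ω-zero (R-beyond (R b) a) (R-beyond (R a) b)

  Ω-col-L : ∀ k b → Ω g k (L b) ≡ - δ k (R b)
  Ω-col-L k b with split g k
  ... | left a  = trans (Ω-LL a b) (cong -_ (sym (δ-↑ˡ↑ʳ a b)))
  ... | right a = trans (Ω-RL a b) (cong -_ (sym (δ-↑ʳ g a b)))

  Ω-col-R : ∀ k b → Ω g k (R b) ≡ δ k (L b)
  Ω-col-R k b with split g k
  ... | left a  = trans (Ω-LR a b) (sym (δ-↑ˡ g a b))
  ... | right a = trans (Ω-RR a b) (sym (δ-↑ʳ↑ˡ a b))

  Ω-row-L : ∀ a k → Ω g (L a) k ≡ δ (R a) k
  Ω-row-L a k with split g k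
  ... | left b  = trans (Ω-LL a b) (sym (δ-↑ʳ↑ˡ a b))
  ... | right b = trans (Ω-LR a b) (sym (δ-↑ʳ g a b))

  Ω-row-R : ∀ a k → Ω g (R a) k ≡ - δ (L a) k
  Ω-row-R a k with split g k
  ... | left b  = trans (Ω-RL a b) (cong -_ (sym (δ-↑ˡ g a b)))
  ... | right b = trans (Ω-RR a b) (cong -_ (sym (δ-↑ˡ↑ʳ a b)))

  Σ-col-L : (f : Fin (g ℕ.+ g) → ℤ) (b : Fin g) → Σfin (λ k → f k * Ω g k (L b)) ≡ - f (R b)
  Σ-col-L f b = begin
    Σfin (λ k → f k * Ω g k (L b))    ≡⟨ Σ-cong (λ k → trans (cong (f k *_) (Ω-col-L k b)) (sym (ℤP.neg-distribʳ-* (f k) _))) ⟩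
    Σfin (λ k → - (f k * δ k (R b)))  ≡⟨ Σ-neg (λ k → f k * δ k (R b)) ⟩
    - Σfin (λ k → f k * δ k (R b))    ≡⟨ cong -_ (Σ-δʳ (R b) f) ⟩
    - f (R b)                         ∎
    where open ≡-Reasoning

  Σ-col-R : (f : Fin (g ℕ.+ g) → ℤ) (b : Fin g) → Σfin (λ k → f k * Ω g k (R b)) ≡ f (L b)
  Σ-col-R f b = trans (Σ-cong (λ k → cong (f k *_) (Ω-col-R k b))) (Σ-δʳ (L b) f)

  Σ-row-L : (f : Fin (g ℕ.+ g) → ℤ) (a : Fin g) → Σfin (λ k → Ω g (L a) k * f k) ≡ f (R a)
  Σ-row-L f a = trans (Σ-cong (λ k → cong (_* f k) (Ω-row-L a k))) (Σ-δ (R a) f)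

  Σ-row-R : (f : Fin (g ℕ.+ g) → ℤ) (a : Fin g) → Σfin (λ k → Ω g (R a) k * f k) ≡ - f (L a)
  Σ-row-R f a = begin
    Σfin (λ k → Ω g (R a) k * f k)    ≡⟨ Σ-cong (λ k → trans (cong (_* f k) (Ω-row-R a k)) (sym (ℤP.neg-distribˡ-* (δ (L a) k) (f k)))) ⟩
    Σfin (λ k → - (δ (L a) k * f k))  ≡⟨ Σ-neg (λ k → δ (L a) k * f k) ⟩
    - Σfin (λ k → δ (L a) k * f k)    ≡⟨ cong -_ (Σ-δ (L a) f) ⟩
    - f (L a)                         ∎
    where open ≡-Reasoning

  open Defect (Ω g)

  defect-LL : ∀ X a b → defect X (L a) (L b) ≡ - X (R b) (L a) + X (R a) (L b)
  defect-LL X a b = cong₂ _+_ (Σ-col-L (λ k → X k (L a)) b) (Σ-row-L (λ k → X k (L b)) a)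

  defect-LR : ∀ X a b → defect X (L a) (R b) ≡ X (L b) (L a) + X (R a) (R b)
  defect-LR X a b = cong₂ _+_ (Σ-col-R (λ k → X k (L a)) b) (Σ-row-L (λ k → X k (R b)) a)

  defect-RL : ∀ X a b → defect X (R a) (L b) ≡ - X (R b) (R a) + - X (L a) (L b)
  defect-RL X a b = cong₂ _+_ (Σ-col-L (λ k → X k (R a)) b) (Σ-row-R (λ k → X k (L b)) a)

  defect-RR : ∀ X a b → defect X (R a) (R b) ≡ X (L b) (R a) + - X (L a) (R b)
  defect-RR X a b = cong₂ _+_ (Σ-col-R (λ k → X k (R a)) b) (Σ-row-R (λ k → X k (R b)) a)

  -- Block shape of an element of gsp with multiplier d: for
  -- X = [[P, Q], [U, V]] the blocks Q and U are symmetric and Pᵀ + V = d I.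
  record GspShape (X : Mat (g ℕ.+ g)) (d : ℤ) : Set where
    field
      lower-sym : ∀ a b → X (R a) (L b) ≡ X (R b) (L a)
      upper-sym : ∀ a b → X (L a) (R b) ≡ X (L b) (R a)
      diagonal  : ∀ a b → X (L b) (L a) + X (R a) (R b) ≡ d * δ a b

  shape⇒defect : ∀ {X d} → GspShape X d → defect X ≐ d · Ω g
  shape⇒defect {X} {d} shape = by-blocks
    (λ a b → begin
      defect X (L a) (L b)                 ≡⟨ defect-LL X a b ⟩
      - X (R b) (L a) + X (R a) (L b)      ≡⟨ cong (- X (R b) (L a) +_) (lower-sym a b) ⟩
      - X (R b) (L a) + X (R b) (L a)      ≡⟨ ℤP.+-inverseˡ (X (R b) (L a)) ⟩
      0ℤ                                   ≡⟨ sym (trans (cong (d *_) (Ω-LL a b)) (ℤP.*-zeroʳ d)) ⟩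
      d * Ω g (L a) (L b)                  ∎)
    (λ a b → begin
      defect X (L a) (R b)                 ≡⟨ defect-LR X a b ⟩
      X (L b) (L a) + X (R a) (R b)        ≡⟨ diagonal a b ⟩
      d * δ a b                            ≡⟨ sym (cong (d *_) (Ω-LR a b)) ⟩
      d * Ω g (L a) (R b)                  ∎)
    (λ a b → begin
      defect X (R a) (L b)                 ≡⟨ defect-RL X a b ⟩
      - X (R b) (R a) + - X (L a) (L b)    ≡⟨ trans (ℤP.+-comm (- X (R b) (R a)) _) (sym (ℤP.neg-distrib-+ (X (L a) (L b)) _)) ⟩
      - (X (L a) (L b) + X (R b) (R a))    ≡⟨ cong -_ (trans (diagonal b a) (cong (d *_) (δ-sym b a))) ⟩
      - (d * δ a b)                        ≡⟨ ℤP.neg-distribʳ-* d (δ a b) ⟩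
      d * - δ a b                          ≡⟨ sym (cong (d *_) (Ω-RL a b)) ⟩
      d * Ω g (R a) (L b)                  ∎)
    (λ a b → begin
      defect X (R a) (R b)                 ≡⟨ defect-RR X a b ⟩
      X (L b) (R a) + - X (L a) (R b)      ≡⟨ cong (λ x → X (L b) (R a) + - x) (upper-sym a b) ⟩
      X (L b) (R a) + - X (L b) (R a)      ≡⟨ ℤP.+-inverseʳ (X (L b) (R a)) ⟩
      0ℤ                                   ≡⟨ sym (trans (cong (d *_) (Ω-RR a b)) (ℤP.*-zeroʳ d)) ⟩
      d * Ω g (R a) (R b)                  ∎)
    where open GspShape shape
          open ≡-Reasoning

  record HasBlocks (X : Mat (g ℕ.+ g)) (P Q U V : Mat g) : Set where
    field
      LL : ∀ a b → X (L a) (L b) ≡ P a b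
      LR : ∀ a b → X (L a) (R b) ≡ Q a b
      RL : ∀ a b → X (R a) (L b) ≡ U a b
      RR : ∀ a b → X (R a) (R b) ≡ V a b

  HasBlocks-⊕ : ∀ {X Y P Q U V P′ Q′ U′ V′} → HasBlocks X P Q U V → HasBlocks Y P′ Q′ U′ V′ →
    HasBlocks (X ⊕ Y) (P ⊕ P′) (Q ⊕ Q′) (U ⊕ U′) (V ⊕ V′)
  HasBlocks-⊕ x y = record
    { LL = λ a b → cong₂ _+_ (X.LL a b) (Y.LL a b)
    ; LR = λ a b → cong₂ _+_ (X.LR a b) (Y.LR a b)
    ; RL = λ a b → cong₂ _+_ (X.RL a b) (Y.RL a b)
    ; RR = λ a b → cong₂ _+_ (X.RR a b) (Y.RR a b)
    }
    where module X = HasBlocks x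
          module Y = HasBlocks y

  HasBlocks-≐ : ∀ {X Y P Q U V} → X ≐ Y → HasBlocks Y P Q U V → HasBlocks X P Q U V
  HasBlocks-≐ X≐Y y = record
    { LL = λ a b → trans (X≐Y (L a) (L b)) (Y.LL a b)
    ; LR = λ a b → trans (X≐Y (L a) (R b)) (Y.LR a b)
    ; RL = λ a b → trans (X≐Y (R a) (L b)) (Y.RL a b)
    ; RR = λ a b → trans (X≐Y (R a) (R b)) (Y.RR a b)
    }
    where module Y = HasBlocks y

module Generators (g : ℕ) where
  open Blocks g

  block : (P Q U V : Mat g) → Mat (g ℕ.+ g)
  block P Q U V = (λ a → P a Vec.++ Q a) Vec.++ (λ a → U a Vec.++ V a)

  module _ (P Q U V : Mat g) where
    private
      upper lower : Fin g → Fin (g ℕ.+ g) → ℤ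
      upper a = P a Vec.++ Q a
      lower a = U a Vec.++ V a
    block-LL : ∀ a b → block P Q U V (L a) (L b) ≡ P a b
    block-LL a b = trans (cong (λ row → row (L b)) (lookup-++ˡ upper lower a)) (lookup-++ˡ (P a) (Q a) b)

    block-LR : ∀ a b → block P Q U V (L a) (R b) ≡ Q a b
    block-LR a b = trans (cong (λ row → row (R b)) (lookup-++ˡ upper lower a)) (lookup-++ʳ (P a) (Q a) b)

    block-RL : ∀ a b → block P Q U V (R a) (L b) ≡ U a b
    block-RL a b = trans (cong (λ row → row (L b)) (lookup-++ʳ upper lower a)) (lookup-++ˡ (U a) (V a) b)

    block-RR : ∀ a b → block P Q U V (R a) (R b) ≡ V a b
    block-RR a b = trans (cong (λ row → row (R b)) (lookup-++ʳ upper lower a)) (lookup-++ʳ (U a) (V a) b)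

  embed : Mat g → Mat (g ℕ.+ g)
  embed P = block P zeroMat zeroMat (λ p q → - P q p)

  embed-shape : ∀ P → GspShape (embed P) 0ℤ
  embed-shape P = record
    { lower-sym = λ a b → trans (block-RL P zeroMat zeroMat _ a b) (sym (block-RL P zeroMat zeroMat _ b a))
    ; upper-sym = λ a b → trans (block-LR P zeroMat zeroMat _ a b) (sym (block-LR P zeroMat zeroMat _ b a))
    ; diagonal  = λ a b → begin
        embed P (L b) (L a) + embed P (R a) (R b) ≡⟨ cong₂ _+_ (block-LL P zeroMat zeroMat _ b a) (block-RR P zeroMat zeroMat _ a b) ⟩
        P b a + - P b a                           ≡⟨ ℤP.+-inverseʳ (P b a) ⟩
        0ℤ                                        ≡⟨ sym (ℤP.*-zeroˡ (δ a b)) ⟩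
        0ℤ * δ a b                                ∎
    }
    where open ≡-Reasoning

  diag-shape : (w : Fin (g ℕ.+ g) → ℤ) (d : ℤ) → (∀ a → w (L a) + w (R a) ≡ d) → GspShape (diag w) d
  diag-shape w d w-sum = record
    { lower-sym = λ a b → trans (off-block (R a) (δ-↑ʳ↑ˡ a b)) (sym (off-block (R b) (δ-↑ʳ↑ˡ b a)))
    ; upper-sym = λ a b → trans (off-block (L a) (δ-↑ˡ↑ʳ a b)) (sym (off-block (L b) (δ-↑ˡ↑ʳ b a)))
    ; diagonal  = λ a b → begin
        w (L b) * δ (L b) (L a) + w (R a) * δ (R a) (R b)
          ≡⟨ cong₂ _+_ (cong (w (L b) *_) (trans (δ-↑ˡ g b a) (δ-sym b a))) (cong (w (R a) *_) (δ-↑ʳ g a b)) ⟩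
        w (L b) * δ a b + w (R a) * δ a b  ≡⟨ cong (_+ w (R a) * δ a b) (sym (δ-transport (λ c → w (L c)) a b)) ⟩
        w (L a) * δ a b + w (R a) * δ a b  ≡⟨ sym (ℤP.*-distribʳ-+ (δ a b) (w (L a)) (w (R a))) ⟩
        (w (L a) + w (R a)) * δ a b        ≡⟨ cong (_* δ a b) (w-sum a) ⟩
        d * δ a b                          ∎
    }
    where
    open ≡-Reasoning
    off-block : ∀ i {j} → δ i j ≡ 0ℤ → diag w i j ≡ 0ℤ
    off-block i δ≡0 = trans (cong (w i *_) δ≡0) (ℤP.*-zeroʳ (w i))

  private
    vanishes : ∀ {x} y → x ≡ 0ℤ → x * y ≡ 0ℤ
    vanishes y refl = ℤP.*-zeroˡ y

  unit-LR-shape : ∀ c → GspShape (unit (L c) (R c)) 0ℤ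
  unit-LR-shape c = record
    { lower-sym = λ a b → trans (vanishes _ (δ-↑ʳ↑ˡ a c)) (sym (vanishes _ (δ-↑ʳ↑ˡ b c)))
    ; upper-sym = λ a b → begin
        δ (L a) (L c) * δ (R c) (R b) ≡⟨ cong₂ _*_ (δ-↑ˡ g a c) (δ-↑ʳ g c b) ⟩
        δ a c * δ c b                 ≡⟨ δδ-sym a b c ⟩
        δ b c * δ c a                 ≡⟨ sym (cong₂ _*_ (δ-↑ˡ g b c) (δ-↑ʳ g c a)) ⟩
        δ (L b) (L c) * δ (R c) (R a) ∎
    ; diagonal  = λ a b → trans (cong₂ _+_ (trans (cong (δ (L b) (L c) *_) (δ-↑ʳ↑ˡ c a)) (ℤP.*-zeroʳ (δ (L b) (L c))))
                                            (vanishes _ (δ-↑ʳ↑ˡ a c)))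
                                (sym (ℤP.*-zeroˡ (δ a b)))
    }
    where open ≡-Reasoning

  unit-RL-shape : ∀ c → GspShape (unit (R c) (L c)) 0ℤ
  unit-RL-shape c = record
    { lower-sym = λ a b → begin
        δ (R a) (R c) * δ (L c) (L b) ≡⟨ cong₂ _*_ (δ-↑ʳ g a c) (δ-↑ˡ g c b) ⟩
        δ a c * δ c b                 ≡⟨ δδ-sym a b c ⟩
        δ b c * δ c a                 ≡⟨ sym (cong₂ _*_ (δ-↑ʳ g b c) (δ-↑ˡ g c a)) ⟩
        δ (R b) (R c) * δ (L c) (L a) ∎
    ; upper-sym = λ a b → trans (vanishes _ (δ-↑ˡ↑ʳ a c)) (sym (vanishes _ (δ-↑ˡ↑ʳ b c)))
    ; diagonal  = λ a b → trans (cong₂ _+_ (vanishes _ (δ-↑ˡ↑ʳ b c))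
                                            (trans (cong (δ (R a) (R c) *_) (δ-↑ˡ↑ʳ c b)) (ℤP.*-zeroʳ (δ (R a) (R c)))))
                                (sym (ℤP.*-zeroˡ (δ a b)))
    }
    where open ≡-Reasoning

module Decomposition (g : ℕ) (M : Mat (g ℕ.+ g)) where
  open Blocks g
  open Generators g

  A B C : Mat g
  A p q = M (L p) (L q)
  B p q = M (L p) (R q)
  C p q = M (R p) (L q)

  -- D = diag(I, 0) has multiplier 1; commuting with it scales the
  -- blocks of a matrix by 0, 1, −1, 0.
  d-weight : Fin (g ℕ.+ g) → ℤ
  d-weight = Vec._++_ {m = g} (λ _ → 1ℤ) (λ _ → 0ℤ)

  D : Mat (g ℕ.+ g)
  D = diag d-weight

  -- H c = diag(E_cc, −E_cc) ∈ sp; Z c = embed (E_cc A) carries row c of A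
  h-weight : Fin g → Fin (g ℕ.+ g) → ℤ
  h-weight c = Vec._++_ {m = g} (λ a → δ a c) (λ a → - δ a c)

  H : Fin g → Mat (g ℕ.+ g)
  H c = diag (h-weight c)

  Z : Fin g → Mat (g ℕ.+ g)
  Z c = embed (λ p q → δ p c * A c q)

  -- The commutators whose sum is M (modulo k, when M ∈ sp modulo k):
  --   [D, [D, M]]                       the off-diagonal blocks B and C,
  --   A_cc [E_{Lc,Rc}, E_{Rc,Lc}]        the diagonal entries of A and of −Aᵀ,
  --   [H c, Z c]                         the off-diagonal entries of row c of A.
  diag-term row-term : Fin g → ℤ × Mat (g ℕ.+ g) × Mat (g ℕ.+ g)
  diag-term c = A c c , unit (L c) (R c) , unit (R c) (L c)
  row-term  c = 1ℤ , H c , Z c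

  terms : List (ℤ × Mat (g ℕ.+ g) × Mat (g ℕ.+ g))
  terms = (1ℤ , D , ⟦ D , M ⟧) ∷ (tabulate diag-term ++ tabulate row-term)

  d-weight-L : ∀ a → d-weight (L a) ≡ 1ℤ
  d-weight-L = lookup-++ˡ {m = g} (λ _ → 1ℤ) (λ _ → 0ℤ)

  d-weight-R : ∀ a → d-weight (R a) ≡ 0ℤ
  d-weight-R = lookup-++ʳ {m = g} (λ _ → 1ℤ) (λ _ → 0ℤ)

  h-weight-L : ∀ c a → h-weight c (L a) ≡ δ a c
  h-weight-L c = lookup-++ˡ {m = g} (λ a → δ a c) (λ a → - δ a c)

  h-weight-R : ∀ c a → h-weight c (R a) ≡ - δ a c
  h-weight-R c = lookup-++ʳ {m = g} (λ a → δ a c) (λ a → - δ a c)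

  D-shape : GspShape D 1ℤ
  D-shape = diag-shape d-weight 1ℤ (λ a → cong₂ _+_ (d-weight-L a) (d-weight-R a))

  H-shape : ∀ c → GspShape (H c) 0ℤ
  H-shape c = diag-shape (h-weight c) 0ℤ
    (λ a → trans (cong₂ _+_ (h-weight-L c a) (h-weight-R c a)) (ℤP.+-inverseʳ (δ a c)))

  off-diagonal-part : HasBlocks (termMat (1ℤ , D , ⟦ D , M ⟧)) zeroMat B C zeroMat
  off-diagonal-part = record
    { LL = λ a b → trans (entry (d-weight-L a) (d-weight-L b)) (ring₀ 1ℤ (M (L a) (L b)))
    ; LR = λ a b → trans (entry (d-weight-L a) (d-weight-R b)) (ring₁ _)
    ; RL = λ a b → trans (entry (d-weight-R a) (d-weight-L b)) (ring₁′ _)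
    ; RR = λ a b → trans (entry (d-weight-R a) (d-weight-R b)) (ring₀ 0ℤ (M (R a) (R b)))
    }
    where
    entry : ∀ {i j x y} → d-weight i ≡ x → d-weight j ≡ y →
            termMat (1ℤ , D , ⟦ D , M ⟧) i j ≡ (x - y) * ((x - y) * M i j)
    entry {i} {j} refl refl = trans (ℤP.*-identityˡ _)
      (trans (⟦diag⟧ d-weight ⟦ D , M ⟧ i j) (cong ((d-weight i - d-weight j) *_) (⟦diag⟧ d-weight M i j)))
    ring₀ : ∀ x m → (x - x) * ((x - x) * m) ≡ 0ℤ
    ring₀ = solve-∀
    ring₁ : ∀ m → (1ℤ - 0ℤ) * ((1ℤ - 0ℤ) * m) ≡ m
    ring₁ = solve-∀
    ring₁′ : ∀ m → (0ℤ - 1ℤ) * ((0ℤ - 1ℤ) * m) ≡ m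
    ring₁′ = solve-∀

  Δ : Mat g
  Δ p q = A p p * δ p q

  diagonal-part : HasBlocks (λ i j → Σfin (λ c → termMat (diag-term c) i j)) Δ zeroMat zeroMat (λ p q → - Δ p q)
  diagonal-part = record
    { LL = λ p q → trans (Σ-cong {g} (λ c → trans (entry c (L p) (L q) (δ-↑ˡ g p c) (δ-↑ˡ g c q) (δ-↑ˡ↑ʳ p c) (δ-↑ʳ↑ˡ c q))
                                              (ring-LL (A c c) (δ p c) (δ c q))))
                         (Σ-δ p (λ c → A c c * δ c q))
    ; LR = λ p q → trans (Σ-cong {g} (λ c → trans (entry c (L p) (R q) (δ-↑ˡ g p c) (δ-↑ˡ↑ʳ c q) (δ-↑ˡ↑ʳ p c) (δ-↑ʳ g c q))
                                              (ring-LR (A c c) (δ p c) (δ c q))))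
                         (Σ-zero {g})
    ; RL = λ p q → trans (Σ-cong {g} (λ c → trans (entry c (R p) (L q) (δ-↑ʳ↑ˡ p c) (δ-↑ˡ g c q) (δ-↑ʳ g p c) (δ-↑ʳ↑ˡ c q))
                                              (ring-RL (A c c) (δ p c) (δ c q))))
                         (Σ-zero {g})
    ; RR = λ p q → trans (Σ-cong {g} (λ c → trans (entry c (R p) (R q) (δ-↑ʳ↑ˡ p c) (δ-↑ˡ↑ʳ c q) (δ-↑ʳ g p c) (δ-↑ʳ g c q))
                                              (ring-RR (A c c) (δ p c) (δ c q))))
                         (trans (Σ-neg (λ c → δ p c * (A c c * δ c q))) (cong -_ (Σ-δ p (λ c → A c c * δ c q))))
    }
    where
    entry : ∀ c i j {x₁ x₂ y₁ y₂} → δ i (L c) ≡ x₁ → δ (L c) j ≡ x₂ → δ i (R c) ≡ y₁ → δ (R c) j ≡ y₂ →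
            termMat (diag-term c) i j ≡ A c c * (x₁ * x₂ - y₁ * y₂)
    entry c i j refl refl refl refl = cong (A c c *_) (⟦unit⟧ (L c) (R c) i j)
    ring-LL : ∀ a x y → a * (x * y - 0ℤ * 0ℤ) ≡ x * (a * y)
    ring-LL = solve-∀
    ring-LR : ∀ a x y → a * (x * 0ℤ - 0ℤ * y) ≡ 0ℤ
    ring-LR = solve-∀
    ring-RL : ∀ a x y → a * (0ℤ * y - x * 0ℤ) ≡ 0ℤ
    ring-RL = solve-∀
    ring-RR : ∀ a x y → a * (0ℤ * 0ℤ - x * y) ≡ - (x * (a * y))
    ring-RR = solve-∀

  A′ : Mat g
  A′ p q = (1ℤ - δ p q) * A p q

  off-diagonal-A-part : HasBlocks (λ i j → Σfin (λ c → termMat (row-term c) i j))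
                                   A′ zeroMat zeroMat (λ p q → - A′ q p)
  off-diagonal-A-part = record
    { LL = λ p q → trans (Σ-cong {g} (λ c → trans (entry c (L p) (L q) (h-weight-L c p) (h-weight-L c q) (block-LL _ _ _ _ p q))
                                              (ring-LL (δ p c) (δ q c) (A c q))))
                         (trans (Σ-δ p (λ c → (δ p c - δ q c) * A c q))
                                (cong₂ (λ u v → (u - v) * A p q) (δ-refl p) (δ-sym q p)))
    ; LR = λ p q → trans (Σ-cong {g} (λ c → vanishing c (block-LR _ _ _ _ p q))) (Σ-zero {g})
    ; RL = λ p q → trans (Σ-cong {g} (λ c → vanishing c (block-RL _ _ _ _ p q))) (Σ-zero {g})
    ; RR = λ p q → trans (Σ-cong {g} (λ c → trans (entry c (R p) (R q) (h-weight-R c p) (h-weight-R c q) (block-RR _ _ _ _ p q))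
                                              (ring-RR (δ p c) (δ q c) (A c p))))
                         (trans (Σ-δ q (λ c → (δ p c - δ q c) * A c p))
                                (trans (cong₂ (λ u v → (u - v) * A q p) (δ-sym p q) (δ-refl q)) (ring-flip (δ q p) (A q p))))
    }
    where
    entry : ∀ c i j {x y z} → h-weight c i ≡ x → h-weight c j ≡ y → Z c i j ≡ z →
            termMat (row-term c) i j ≡ (x - y) * z
    entry c i j refl refl refl = trans (ℤP.*-identityˡ _) (⟦diag⟧ (h-weight c) (Z c) i j)
    vanishing : ∀ c {i j} → Z c i j ≡ 0ℤ → termMat (row-term c) i j ≡ 0ℤ
    vanishing c {i} {j} z≡0 = trans (entry c i j refl refl z≡0) (ℤP.*-zeroʳ (h-weight c i - h-weight c j))
    ring-LL : ∀ x y a → (x - y) * (x * a) ≡ x * ((x - y) * a)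
    ring-LL = solve-∀
    ring-RR : ∀ x y a → (- x - - y) * - (y * a) ≡ y * ((x - y) * a)
    ring-RR = solve-∀
    ring-flip : ∀ e a → (e - 1ℤ) * a ≡ - ((1ℤ - e) * a)
    ring-flip = solve-∀

  combo-blocks : HasBlocks (combo terms)
    (zeroMat ⊕ (Δ ⊕ A′)) (B ⊕ (zeroMat ⊕ zeroMat)) (C ⊕ (zeroMat ⊕ zeroMat))
    (zeroMat ⊕ ((λ p q → - Δ p q) ⊕ (λ p q → - A′ q p)))
  combo-blocks = HasBlocks-≐ split-terms
    (HasBlocks-⊕ off-diagonal-part (HasBlocks-⊕ diagonal-part off-diagonal-A-part))
    where
    split-terms : combo terms ≐ termMat (1ℤ , D , ⟦ D , M ⟧)
      ⊕ ((λ i j → Σfin (λ c → termMat (diag-term c) i j)) ⊕ (λ i j → Σfin (λ c → termMat (row-term c) i j)))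
    split-terms i j = cong (termMat (1ℤ , D , ⟦ D , M ⟧) i j +_)
      (trans (combo-++ (tabulate diag-term) (tabulate row-term) i j)
             (cong₂ _+_ (combo-tabulate diag-term i j) (combo-tabulate row-term i j)))

  module _ (k : ℤ) where
    open Congruence k
    open Defect (Ω g)
    open Modulo k

    decomposition : defect M ≈ₘ zeroMat → M ≈ₘ combo terms
    decomposition M∈sp = by-blocks
      (λ p q → ≈-reflexive (sym (trans (LL p q) (trans (ℤP.+-identityˡ _)
                                  (select p q (A p p) (A p q) (λ { refl → refl }))))))
      (λ p q → ≈-reflexive (sym (trans (LR p q) (ℤP.+-identityʳ _))))
      (λ p q → ≈-reflexive (sym (trans (RL p q) (ℤP.+-identityʳ _))))
      (λ p q → ≈-trans (last-block p q) (≈-reflexive (sym (trans (RR p q) (minus-transpose p q)))))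
      where
      open HasBlocks combo-blocks
      open ≡-Reasoning
      -- the sp condition in the diagonal blocks: M_RR ≡ −Aᵀ
      last-block : ∀ p q → M (R p) (R q) ≈ - A q p
      last-block p q = ≈-neg-of-sum (subst (_≈ 0ℤ) (defect-LR M p q) (M∈sp (L p) (R q)))
      minus-transpose : ∀ p q → 0ℤ + (- Δ p q + - A′ q p) ≡ - A q p
      minus-transpose p q = begin
        0ℤ + (- Δ p q + - A′ q p)                           ≡⟨ ℤP.+-identityˡ _ ⟩
        - (A p p * δ p q) + - ((1ℤ - δ q p) * A q p)        ≡⟨ sym (ℤP.neg-distrib-+ (A p p * δ p q) _) ⟩
        - (A p p * δ p q + (1ℤ - δ q p) * A q p)            ≡⟨ cong (λ e → - (A p p * δ p q + (1ℤ - e) * A q p)) (δ-sym q p) ⟩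
        - (A p p * δ p q + (1ℤ - δ p q) * A q p)            ≡⟨ cong -_ (select p q (A p p) (A q p) (λ { refl → refl })) ⟩
        - A q p                                             ∎

module Theorem (g ℓ : ℕ) where
  open Congruence (Int.+ ℓ)
  open Blocks g
  open Generators g
  open Defect (Ω g)
  open Modulo (Int.+ ℓ)

  from-mod : ∀ (A B : Mat (g ℕ.+ g)) → A ≡M B [mod ℓ ] → A ≈ₘ B
  from-mod A B A≡B i j = mod (Signed.∣ᵤ⇒∣ (A≡B i j))

  to-mod : ∀ (A B : Mat (g ℕ.+ g)) → A ≈ₘ B → A ≡M B [mod ℓ ]
  to-mod A B A≈B i j = Signed.∣⇒∣ᵤ (divides (A≈B i j))

  gsp⇒multiplier : ∀ {X} → InGsp g ℓ X → Σ ℤ (HasMultiplier X)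
  gsp⇒multiplier {X} (d , X∈gsp) = d , from-mod (defect X) (d · Ω g) X∈gsp

  multiplier⇒gsp : ∀ {X d} → HasMultiplier X d → InGsp g ℓ X
  multiplier⇒gsp {X} {d} hX = d , to-mod (defect X) (d · Ω g) hX

  shape⇒gsp : ∀ {X d} → GspShape X d → InGsp g ℓ X
  shape⇒gsp {X} {d} shape = multiplier⇒gsp {X} {d} (λ i j → ≈-reflexive (shape⇒defect shape i j))

  sp⇒multiplier : ∀ {X} → InSp g ℓ X → HasMultiplier X 0ℤ
  sp⇒multiplier {X} X∈sp i j = ≈-trans (from-mod (defect X) zeroMat X∈sp i j) (≈-reflexive (sym (ℤP.*-zeroˡ (Ω g i j))))

  bracket⊆sp : (M : Mat (g ℕ.+ g)) → InBracketGsp g ℓ M → InSp g ℓ M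
  bracket⊆sp M (ts , ts∈gsp , M≡combo) = to-mod (defect M) zeroMat (λ i j → ≈-trans
    (defect-cong≈ {M} {combo ts} (from-mod M (combo ts) M≡combo) i j)
    (defect-combo≈0 ts (All.map (λ (X∈gsp , Y∈gsp) → gsp⇒multiplier X∈gsp , gsp⇒multiplier Y∈gsp) ts∈gsp) i j))

  sp⊆bracket : (M : Mat (g ℕ.+ g)) → InSp g ℓ M → InBracketGsp g ℓ M
  sp⊆bracket M M∈sp = terms , generators∈gsp , to-mod M (combo terms) (decomposition (Int.+ ℓ) (from-mod (defect M) zeroMat M∈sp))
    where
    open Decomposition g M
    [D,M]∈gsp : InGsp g ℓ ⟦ D , M ⟧
    [D,M]∈gsp = multiplier⇒gsp {d = 0ℤ} (λ i j → ≈-trans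
      (defect-⟦⟧≈0 D M 1ℤ 0ℤ (λ i j → ≈-reflexive (shape⇒defect D-shape i j)) (sp⇒multiplier M∈sp) i j)
      (≈-reflexive (sym (ℤP.*-zeroˡ (Ω g i j)))))
    generators∈gsp : All (λ t → InGsp g ℓ (proj₁ (proj₂ t)) × InGsp g ℓ (proj₂ (proj₂ t))) terms
    generators∈gsp = (shape⇒gsp D-shape , [D,M]∈gsp)
      ∷ ++⁺ (tabulate⁺ (λ c → shape⇒gsp (unit-LR-shape c) , shape⇒gsp (unit-RL-shape c)))
            (tabulate⁺ (λ c → shape⇒gsp (H-shape c) , shape⇒gsp (embed-shape _)))

lemma2p3 : (g ℓ : ℕ) → 0 < g → Prime ℓ →
    (M : Mat (g Data.Nat.+ g)) →
    (InBracketGsp g ℓ M → InSp g ℓ M) × (InSp g ℓ M → InBracketGsp g ℓ M)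
lemma2p3 g ℓ _ _ M = bracket⊆sp M , sp⊆bracket M
  where open Theorem g ℓ
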